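{- Let $N=(V,E,r,X)$ be a DC $X$-network, let $v$ be a vertex with $v\neq r$ and $v\notin X$, and let $(a,b)$ be a redundant arc of $N$. Then: (1) for vertices $u,w$ distinct from $v$, there is a directed path from $u$ to $w$ in $D(v)N$ iff there is one in $N$; (2) $D(v)N$ is a DC $X$-network; (3) for every vertex $w\neq v$ of $N$, $cl(w;D(v)N)=cl(w;N)$; (4) for vertices $u,w$, there is a directed path from $u$ to $w$ in $D(a,b)N$ iff there is one in $N$; (5) $D(a,b)N$ is a DC $X$-network; (6) for every vertex $w$ of $N$, $cl(w;D(a,b)N)=cl(w;N)$; (7) for vertices $u,w$ of $N$ other than $v$, $u<w$ in $N$ iff $u<w$ in $D(v)N$; (8) for vertices $u,w$ of $N$, $u<w$ in $N$ iff $u<w$ in $D(a,b)N$.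
   Context: An $X$-network $N=(V,E,r,X)$ is a finite directed graph (no loops, no multiple arcs) that is acyclic, has a root $r$ (every vertex reachable from $r$ by a directed path), and whose leaves (out-degree $0$) are identified bijectively with $X$. Directed paths may have length $0$. The cluster of $v$ is $cl(v;N)=\{x\in X:\text{there is a directed path from } v\text{ to } x\}$; $N$ is distinct-cluster (DC) if distinct vertices have distinct clusters. $u<w$ means there is a directed path from $u$ to $w$ and $u\neq w$. An arc $(a,b)$ is redundant if there is a directed path from $a$ to $b$ of length greater than $1$. For $v\neq r$, $v\notin X$ with parents $q_1,\dots,q_k$ and children $c_1,\dots,c_m$, $D(v)N$ is obtained by deleting $v$ and all arcs incident with $v$ and adding arcs $(q_i,c_j)$ for all $i,j$ (keeping a single copy if already present); it has vertex set $V\setminus\{v\}$ and root $r$. $D(a,b)N$ is obtained from $N$ by deleting the arc $(a,b)$. -}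

module Defs where

open import Data.Nat using (ℕ; zero; suc; _≤_)
open import Data.Bool using (Bool; true; false; _∧_; _∨_; not)
open import Data.Fin using (Fin; punchIn; punchOut; _≟_)
open import Data.Product using (Σ; ∃; _×_; _,_)
open import Relation.Nullary using (¬_)
open import Relation.Nullary.Decidable using (⌊_⌋)
open import Relation.Binary.PropositionalEquality using (_≡_; _≢_)
open import Function.Bundles using (_⇔_)
open import Function.Definitions using (Injective)

-- A finite directed graph on the vertex set Fin n, given by its
-- (Boolean) adjacency matrix; hence there are no multiple arcs.
record Graph (n : ℕ) : Set where
  constructor graph
  field
    arc : Fin n → Fin n → Bool
open Graph public

module _ {n : ℕ} (G : Graph n) where

  Arc : Fin n → Fin n → Set
  Arc u w = arc G u w ≡ true

  data Path : Fin n → Fin n → Set where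
    here : ∀ {u} → Path u u
    step : ∀ {u w z} → Arc u w → Path w z → Path u z

  length : ∀ {u w} → Path u w → ℕ
  length here = zero
  length (step _ p) = suc (length p)

  Lt : Fin n → Fin n → Set
  Lt u w = Path u w × u ≢ w

  IsLeaf : Fin n → Set
  IsLeaf u = ∀ w → arc G u w ≡ false

  Redundant : Fin n → Fin n → Set
  Redundant a b = Arc a b × Σ (Path a b) (λ p → 2 ≤ length p)

  module _ {X : Set} (ℓ : X → Fin n) where

    cl : Fin n → X → Set
    cl v x = Path v (ℓ x)



SameCluster : ∀ {X : Set} {n m : ℕ} (G : Graph n) (H : Graph m) →
              (ℓ : X → Fin n) (ℓ' : X → Fin m) → Fin n → Fin m → Set
SameCluster {X} G H ℓ ℓ' u w = ∀ (x : X) → cl G ℓ u x ⇔ cl H ℓ' w x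

module _ {n : ℕ} (G : Graph n) where

  record IsNetwork {X : Set} (r : Fin n) (ℓ : X → Fin n) : Set where
    field
      noLoops   : ∀ u → arc G u u ≡ false
      acyclic   : ∀ u (p : Path G u u) → length G p ≡ 0
      rooted    : ∀ u → Path G r u
      ℓ-inj     : Injective _≡_ _≡_ ℓ
      ℓ-leaf    : ∀ x → IsLeaf G (ℓ x)
      leaf-ℓ    : ∀ u → IsLeaf G u → ∃ (λ x → ℓ x ≡ u)

  record IsDCNetwork {X : Set} (r : Fin n) (ℓ : X → Fin n) : Set where
    field
      isNetwork : IsNetwork r ℓ
      distinctClusters : ∀ u w → SameCluster G G ℓ ℓ u w → u ≡ w

-- D(v)N.  Vertex j of D(v)N (j : Fin m) is the vertex punchIn v j of N,
-- i.e. the vertices of D(v)N are exactly the vertices of N other than v.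
Dv : ∀ {m} → Graph (suc m) → Fin (suc m) → Graph m
Dv G v = graph (λ i j →
  let u = punchIn v i ; w = punchIn v j in
  arc G u w ∨ (arc G u v ∧ arc G v w))

Dv-root : ∀ {m} (v r : Fin (suc m)) → v ≢ r → Fin m
Dv-root v r v≢r = punchOut v≢r

Dv-label : ∀ {m} {X : Set} (ℓ : X → Fin (suc m)) (v : Fin (suc m)) →
           (∀ x → v ≢ ℓ x) → X → Fin m
Dv-label ℓ v h x = punchOut (h x)

Dab : ∀ {n} → Graph n → Fin n → Fin n → Graph n
Dab G a b = graph (λ u w → arc G u w ∧ not (⌊ u ≟ a ⌋ ∧ ⌊ w ≟ b ⌋))

-- Both operations leave reachability among the surviving vertices unchanged: in D(v)N a
-- path through v uses arcs q → v → c, which are replaced by the arc q → c, and in D(a,b)N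
-- the arc (a,b) is replaced by the longer a–b path, which by acyclicity never uses (a,b).
-- An injective vertex map that preserves and reflects reachability transfers clusters,
-- the strict order, rootedness, acyclicity (reachability in an acyclic graph is
-- antisymmetric) and distinctness of clusters; only loops and leaves need a separate check.
module Submission where

open import Defs
open import Data.Nat using (ℕ; suc; _≤_; s≤s)
open import Data.Fin using (Fin; punchIn; punchOut; _≟_)
open import Data.Fin.Properties using (punchIn-injective; punchInᵢ≢i; punchIn-punchOut; ¬∀⟶∃¬)
open import Data.Bool using (true; false; _∧_; _∨_; not)
open import Data.Bool.Properties using (¬-not; not-¬) renaming (_≟_ to _≟ᵇ_)
open import Data.Product using (∃; _×_; _,_; proj₁; proj₂)
open import Data.Sum using (_⊎_; inj₁; inj₂; [_,_])
open import Data.Empty using (⊥)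
open import Function using (_∘_; id)
open import Function.Bundles using (_⇔_; mk⇔; Equivalence)
import Function.Properties.Equivalence as ⇔
open import Function.Definitions using (Injective)
open import Relation.Nullary using (¬_; Dec; yes; no; contradiction)
open import Relation.Nullary.Decidable using (⌊_⌋; _×-dec_)
open import Relation.Binary.PropositionalEquality using (_≡_; _≢_; refl; sym; trans; cong; subst)

open Equivalence using (to; from)

∧-≡true⇔ : ∀ {x y} → x ∧ y ≡ true ⇔ (x ≡ true × y ≡ true)
∧-≡true⇔ {true}  = mk⇔ (refl ,_) proj₂
∧-≡true⇔ {false} = mk⇔ (λ ()) (λ ())

∨-∧-≡true⇔ : ∀ {x y z} → x ∨ (y ∧ z) ≡ true ⇔ (x ≡ true ⊎ (y ≡ true × z ≡ true))
∨-∧-≡true⇔ {true}  = mk⇔ (λ _ → inj₁ refl) (λ _ → refl)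
∨-∧-≡true⇔ {false} = mk⇔ (inj₂ ∘ to ∧-≡true⇔) [ (λ ()) , from ∧-≡true⇔ ]

not-⌊⌋∧⌊⌋≡true⇔ : ∀ {P Q : Set} (P? : Dec P) (Q? : Dec Q) → not (⌊ P? ⌋ ∧ ⌊ Q? ⌋) ≡ true ⇔ (¬ (P × Q))
not-⌊⌋∧⌊⌋≡true⇔ (yes p) (yes q) = mk⇔ (λ ()) (λ ¬pq → contradiction (p , q) ¬pq)
not-⌊⌋∧⌊⌋≡true⇔ (yes _) (no ¬q) = mk⇔ (λ _ → ¬q ∘ proj₂) (λ _ → refl)
not-⌊⌋∧⌊⌋≡true⇔ (no ¬p) _       = mk⇔ (λ _ → ¬p ∘ proj₁) (λ _ → refl)

module _ {n : ℕ} {G : Graph n} where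

  _++ᵖ_ : ∀ {u w z} → Path G u w → Path G w z → Path G u z
  here     ++ᵖ q = q
  step e p ++ᵖ q = step e (p ++ᵖ q)

  leaf-Path : ∀ {u w} → IsLeaf G u → Path G u w → u ≡ w
  leaf-Path lf here       = refl
  leaf-Path lf (step e _) = contradiction e (not-¬ (lf _))

Path-map : ∀ {k n} {H : Graph k} {G : Graph n} (f : Fin k → Fin n) →
           (∀ {i j} → Arc H i j → Path G (f i) (f j)) →
           ∀ {i j} → Path H i j → Path G (f i) (f j)
Path-map f arc⇒Path here       = here
Path-map f arc⇒Path (step e p) = arc⇒Path e ++ᵖ Path-map f arc⇒Path p

module _ {n : ℕ} {X : Set} {G : Graph n} {r : Fin n} {ℓ : X → Fin n}
         (N : IsNetwork G r ℓ) where
  open IsNetwork N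

  Arc⇒¬Path-back : ∀ {u w} → Arc G u w → ¬ Path G w u
  Arc⇒¬Path-back {u} e p with acyclic u (step e p)
  ... | ()

  Path-antisym : ∀ {u w} → Path G u w → Path G w u → u ≡ w
  Path-antisym here       _ = refl
  Path-antisym (step e p) q = contradiction (p ++ᵖ q) (Arc⇒¬Path-back e)

  nonLabel⇒child : ∀ {v} → (∀ x → v ≢ ℓ x) → ∃ (Arc G v)
  nonLabel⇒child {v} v∉X =
    let z , ¬z = ¬∀⟶∃¬ _ (λ w → arc G v w ≡ false) (λ w → arc G v w ≟ᵇ false)
                       (λ lf → let x , ℓx≡v = leaf-ℓ v lf in v∉X x (sym ℓx≡v))
    in z , ¬-not {y = false} ¬z

record ReachabilityEmbedding {k n : ℕ} (H : Graph k) (G : Graph n) : Set where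
  field
    embed           : Fin k → Fin n
    embed-injective : Injective _≡_ _≡_ embed
    reach           : ∀ i j → Path H i j ⇔ Path G (embed i) (embed j)

module _ {k n : ℕ} {H : Graph k} {G : Graph n} (E : ReachabilityEmbedding H G) where
  open ReachabilityEmbedding E

  Lt-embed : ∀ i j → Lt G (embed i) (embed j) ⇔ Lt H i j
  Lt-embed i j = mk⇔ (λ (p , i≢j) → from (reach i j) p , i≢j ∘ cong embed)
                     (λ (p , i≢j) → to (reach i j) p , i≢j ∘ embed-injective)

  module _ {X : Set} {ℓ′ : X → Fin k} {ℓ : X → Fin n}
           (embed-label : ∀ x → embed (ℓ′ x) ≡ ℓ x) where

    cl-embed : ∀ j → SameCluster H G ℓ′ ℓ j (embed j)
    cl-embed j x rewrite sym (embed-label x) = reach j (ℓ′ x)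

    isDCNetwork-embed : ∀ {r r′} → embed r′ ≡ r →
                        (∀ i → arc H i i ≡ false) →
                        (∀ i → IsLeaf H i → IsLeaf G (embed i)) →
                        IsDCNetwork G r ℓ → IsDCNetwork H r′ ℓ′
    isDCNetwork-embed {r} {r′} embed-root noLoopsH leaf⇒leaf N = record
      { isNetwork = record
        { noLoops = noLoopsH
        ; acyclic = acyclicH
        ; rooted  = λ j → from (reach r′ j)
                            (subst (λ t → Path G t (embed j)) (sym embed-root) (rooted (embed j)))
        ; ℓ-inj   = λ ℓ′x≡ℓ′y → ℓ-inj (trans (sym (embed-label _))
                                        (trans (cong embed ℓ′x≡ℓ′y) (embed-label _)))
        ; ℓ-leaf  = ℓ′-leaf
        ; leaf-ℓ  = λ i lf → let x , ℓx≡ei = leaf-ℓ (embed i) (leaf⇒leaf i lf)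
                             in x , embed-injective (trans (embed-label x) ℓx≡ei)
        }
      ; distinctClusters = λ i j same → embed-injective (distinctClusters (embed i) (embed j)
          λ x → ⇔.trans (⇔.sym (cl-embed i x)) (⇔.trans (same x) (cl-embed j x)))
      }
      where
      open IsDCNetwork N
      open IsNetwork isNetwork

      ¬loopH : ∀ {i j} → Arc H i j → i ≢ j
      ¬loopH e refl = contradiction e (not-¬ (noLoopsH _))

      acyclicH : ∀ i (p : Path H i i) → length H p ≡ 0
      acyclicH i here       = refl
      acyclicH i (step e p) = contradiction
        (embed-injective (Path-antisym isNetwork (to (reach _ _) (step e here)) (to (reach _ _) p)))
        (¬loopH e)

      -- an arc of H out of ℓ′ x maps to a path out of the leaf ℓ x of G, so it is a loop
      ℓ′-leaf : ∀ x → IsLeaf H (ℓ′ x)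
      ℓ′-leaf x j = ¬-not {y = true} λ e → ¬loopH e (embed-injective
        (trans (embed-label x) (leaf-Path (ℓ-leaf x) (subst (λ t → Path G t (embed j))
          (embed-label x) (to (reach _ _) (step e here))))))

data PunchView {m : ℕ} (v : Fin (suc m)) : Fin (suc m) → Set where
  hole      : PunchView v v
  punchedIn : ∀ k → PunchView v (punchIn v k)

punchView : ∀ {m} (v w : Fin (suc m)) → PunchView v w
punchView v w with v ≟ w
... | yes refl = hole
... | no v≢w   = subst (PunchView v) (punchIn-punchOut v≢w) (punchedIn (punchOut v≢w))

module _ {m : ℕ} (G : Graph (suc m)) (v : Fin (suc m)) where

  Dv-arc⇔ : ∀ i k → Arc (Dv G v) i k ⇔
            (Arc G (punchIn v i) (punchIn v k) ⊎ (Arc G (punchIn v i) v × Arc G v (punchIn v k)))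
  Dv-arc⇔ i k = ∨-∧-≡true⇔

  Dv-Path⇒Path : ∀ {i j} → Path (Dv G v) i j → Path G (punchIn v i) (punchIn v j)
  Dv-Path⇒Path = Path-map (punchIn v) λ {i} {k} e →
    [ (λ e₁ → step e₁ here) , (λ (e₁ , e₂) → step e₁ (step e₂ here)) ] (to (Dv-arc⇔ i k) e)

  -- The path is lifted arc by arc; an arc into v is held back until the next arc out of v.
  mutual
    Path⇒Dv-Path : ∀ i {w} j → w ≡ punchIn v j → Path G (punchIn v i) w → Path (Dv G v) i j
    Path⇒Dv-Path i j w≡j here =
      subst (Path (Dv G v) i) (punchIn-injective v i j w≡j) here
    Path⇒Dv-Path i j w≡j (step {w = w} e p) with punchView v w
    ... | hole        = Path⇒Dv-Path-via i j w≡j e p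
    ... | punchedIn k = step (from (Dv-arc⇔ i k) (inj₁ e)) (Path⇒Dv-Path k j w≡j p)

    Path⇒Dv-Path-via : ∀ i {w} j → w ≡ punchIn v j → Arc G (punchIn v i) v → Path G v w →
                       Path (Dv G v) i j
    Path⇒Dv-Path-via i j w≡j e here = contradiction (sym w≡j) (punchInᵢ≢i v j)
    Path⇒Dv-Path-via i j w≡j e (step {w = w} e′ p) with punchView v w
    ... | hole        = Path⇒Dv-Path-via i j w≡j e p
    ... | punchedIn k = step (from (Dv-arc⇔ i k) (inj₂ (e , e′))) (Path⇒Dv-Path k j w≡j p)

  Dv-embedding : ReachabilityEmbedding (Dv G v) G
  Dv-embedding = record
    { embed           = punchIn v
    ; embed-injective = punchIn-injective v _ _
    ; reach           = λ i j → mk⇔ Dv-Path⇒Path (Path⇒Dv-Path i j refl)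
    }

  module _ {X : Set} {r : Fin (suc m)} {ℓ : X → Fin (suc m)} (N : IsNetwork G r ℓ)
           (v∉X : ∀ x → v ≢ ℓ x) where
    open IsNetwork N

    Dv-noLoops : ∀ i → arc (Dv G v) i i ≡ false
    Dv-noLoops i = ¬-not {y = true} λ e → [ not-¬ (noLoops _)
      , (λ (e₁ , e₂) → Arc⇒¬Path-back N e₁ (step e₂ here)) ] (to (Dv-arc⇔ i i) e)

    Dv-leaf⇒leaf : ∀ i → IsLeaf (Dv G v) i → IsLeaf G (punchIn v i)
    Dv-leaf⇒leaf i lf w = ¬-not {y = true} (λ e → ¬Arc-out w e (punchView v w))
      where
      ¬Dv-arc : ∀ {k} → ¬ Arc (Dv G v) i k
      ¬Dv-arc = not-¬ (lf _)

      ¬Arc-out : ∀ w → Arc G (punchIn v i) w → PunchView v w → ⊥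
      ¬Arc-out _ e (punchedIn k) = ¬Dv-arc (from (Dv-arc⇔ i k) (inj₁ e))
      -- v is not a label, so it has a child, which D(v)N turns into a child of i
      ¬Arc-out _ e hole with nonLabel⇒child N v∉X
      ... | z , e′ with punchView v z
      ...   | hole        = not-¬ (noLoops v) e′
      ...   | punchedIn k = ¬Dv-arc (from (Dv-arc⇔ i k) (inj₂ (e , e′)))

module _ {n : ℕ} (G : Graph n) (a b : Fin n) where

  Dab-arc⇔ : ∀ u w → Arc (Dab G a b) u w ⇔ (Arc G u w × ¬ (u ≡ a × w ≡ b))
  Dab-arc⇔ u w = mk⇔ (λ e → let e₁ , e₂ = to ∧-≡true⇔ e in e₁ , to uw≢ab⇔ e₂)
                     (λ (e₁ , e₂) → from ∧-≡true⇔ (e₁ , from uw≢ab⇔ e₂))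
    where
    uw≢ab⇔ : not (⌊ u ≟ a ⌋ ∧ ⌊ w ≟ b ⌋) ≡ true ⇔ (¬ (u ≡ a × w ≡ b))
    uw≢ab⇔ = not-⌊⌋∧⌊⌋≡true⇔ (u ≟ a) (w ≟ b)

  Dab-Path⇒Path : ∀ {u w} → Path (Dab G a b) u w → Path G u w
  Dab-Path⇒Path = Path-map id λ {u} {w} e → step (proj₁ (to (Dab-arc⇔ u w) e)) here

  Path-avoiding⇒Dab-Path : ∀ {u w} → ¬ Path G u a → Path G u w → Path (Dab G a b) u w
  Path-avoiding⇒Dab-Path ¬u⇝a here = here
  Path-avoiding⇒Dab-Path {u} ¬u⇝a (step e p) =
    step (from (Dab-arc⇔ _ _) (e , λ (u≡a , _) → ¬u⇝a (subst (Path G u) u≡a here)))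
         (Path-avoiding⇒Dab-Path (¬u⇝a ∘ step e) p)

  module _ {X : Set} {r : Fin n} {ℓ : X → Fin n} (N : IsNetwork G r ℓ) (red : Redundant G a b) where
    open IsNetwork N

    -- The long a–b path survives the deletion: after its first arc a → c (c ≠ b)
    -- it never returns to a, so it never uses the arc (a, b).
    Dab-bypass : Path (Dab G a b) a b
    Dab-bypass = bypass (proj₁ (proj₂ red)) (proj₂ (proj₂ red))
      where
      bypass : (p : Path G a b) → 2 ≤ length G p → Path (Dab G a b) a b
      bypass (step e₁ (step e₂ p)) _ =
        step (from (Dab-arc⇔ _ _) (e₁ , λ { (_ , refl) → Arc⇒¬Path-back N e₂ p }))
             (Path-avoiding⇒Dab-Path (Arc⇒¬Path-back N e₁) (step e₂ p))
      bypass (step _ here) (s≤s ())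

    Path⇒Dab-Path : ∀ {u w} → Path G u w → Path (Dab G a b) u w
    Path⇒Dab-Path = Path-map id λ {u} {w} e → arc⇒Dab-Path e ((u ≟ a) ×-dec (w ≟ b))
      where
      arc⇒Dab-Path : ∀ {u w} → Arc G u w → Dec (u ≡ a × w ≡ b) → Path (Dab G a b) u w
      arc⇒Dab-Path e (yes (refl , refl)) = Dab-bypass
      arc⇒Dab-Path e (no ab≢)            = step (from (Dab-arc⇔ _ _) (e , ab≢)) here

    Dab-embedding : ReachabilityEmbedding (Dab G a b) G
    Dab-embedding = record
      { embed           = id
      ; embed-injective = id
      ; reach           = λ _ _ → mk⇔ Dab-Path⇒Path Path⇒Dab-Path
      }

    Dab-noLoops : ∀ u → arc (Dab G a b) u u ≡ false
    Dab-noLoops u rewrite noLoops u = refl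

    Dab-leaf⇒leaf : ∀ u → IsLeaf (Dab G a b) u → IsLeaf G u
    Dab-leaf⇒leaf u lf w = ¬-not {y = true} λ e →
      not-¬ (noLoops u) (subst (Arc G u) (sym (leaf-Path lf (Path⇒Dab-Path (step e here)))) e)

theorem5p1 : ∀ {m : ℕ} {X : Set} (G : Graph (suc m)) (r : Fin (suc m)) (ℓ : X → Fin (suc m)) →
    IsDCNetwork G r ℓ →
    (v : Fin (suc m)) (v≢r : v ≢ r) (v∉X : ∀ x → v ≢ ℓ x) →
    (a b : Fin (suc m)) → Redundant G a b →
    ((∀ (i j : Fin m) → Path (Dv G v) i j ⇔ Path G (punchIn v i) (punchIn v j))
    × IsDCNetwork (Dv G v) (Dv-root v r v≢r) (Dv-label ℓ v v∉X)
    × (∀ (j : Fin m) → SameCluster (Dv G v) G (Dv-label ℓ v v∉X) ℓ j (punchIn v j))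
    × (∀ (u w : Fin (suc m)) → Path (Dab G a b) u w ⇔ Path G u w)
    × IsDCNetwork (Dab G a b) r ℓ
    × (∀ (w : Fin (suc m)) → SameCluster (Dab G a b) G ℓ ℓ w w)
    × (∀ (i j : Fin m) → Lt G (punchIn v i) (punchIn v j) ⇔ Lt (Dv G v) i j)
    × (∀ (u w : Fin (suc m)) → Lt G u w ⇔ Lt (Dab G a b) u w))
theorem5p1 G r ℓ N v v≢r v∉X a b red =
    ReachabilityEmbedding.reach Ev
  , isDCNetwork-embed Ev Dv-label-embed (punchIn-punchOut v≢r)
      (Dv-noLoops G v network v∉X) (Dv-leaf⇒leaf G v network v∉X) N
  , cl-embed Ev Dv-label-embed
  , ReachabilityEmbedding.reach Eab
  , isDCNetwork-embed Eab (λ _ → refl) refl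
      (Dab-noLoops G a b network red) (Dab-leaf⇒leaf G a b network red) N
  , cl-embed Eab (λ _ → refl)
  , Lt-embed Ev
  , Lt-embed Eab
  where
  network : IsNetwork G r ℓ
  network = IsDCNetwork.isNetwork N

  Ev : ReachabilityEmbedding (Dv G v) G
  Ev = Dv-embedding G v

  Eab : ReachabilityEmbedding (Dab G a b) G
  Eab = Dab-embedding G a b network red

  Dv-label-embed : ∀ x → punchIn v (Dv-label ℓ v v∉X x) ≡ ℓ x
  Dv-label-embed x = punchIn-punchOut (v∉X x)
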